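{- In a run of the algorithm StochasticSort (defined in the context), after $x_1,\dots,x_\ell$ have been discovered and all the corresponding level updates (incremental updates and rebuilds) have been performed, the vertex $x_{\ell+1}$ belongs to level $L_1$.
   Context: Stochastic generalized sorting: there are $n$ vertices $V$ with an unknown true order $x_1 \prec \cdots \prec x_n$. The undirected graph $G=(V,E)$ is given: each pair $(x_i,x_{i+1})$ is an edge, and every other pair is an edge independently with probability $p$. A query of an edge $(u,v)\in E$ reveals which of $u,v$ comes first; only edges of $E$ may be queried. Edge sets: $q=\Theta(\log(pn))$ is a positive integer depending only on $n,p$; $\alpha\in[1,2]$ solves $\prod_{i=1}^q (1-\alpha p/2^i) = 1-p$; for each edge $e\in E$ independently, draw independent $X_i\sim$ Bernoulli$(\alpha p/2^i)$, $i\le q$, conditioned on some $X_i=1$, and put $e\in E_i$ iff $X_i=1$. Algorithm StochasticSort: $c$ is a sufficiently large constant, $s_i=2^i/p$. Levels $L_1\subseteq\cdots\subseteq L_{q+c}$ are sets of undiscovered vertices; $L_{q+1},\dots,L_{q+c}$ contain all undiscovered vertices. Rule for building $L_i$ from $L_{i+1}$: $v\in L_{i+1}$ is excluded from $L_i$ ("blocked by the edge $(u,v)$") iff some $u\in L_{i+c}$ has $(u,v)\in E_i$ and $u\prec v$ (determined by querying); otherwise $v\in L_i$. Initially levels are built top-down by this rule. After each discovery of $x_\ell$: remove $x_\ell$ from all levels; for each $v$ currently blocked by an edge $(x_\ell,v)$, say $v\in L_{j+1}\setminus L_j$, repeatedly: if no $u\in L_{j+c}$ has $(u,v)\in E_j$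 and $u\prec v$, add $v$ to $L_j$ and continue with $j-1$, stopping when $v\in L_1$ or when $v$ is blocked by a new edge; then, for every $i$ with $\ell$ a multiple of $s_i/32$, rebuild $L_i,L_{i-1},\dots,L_1$ in order from scratch by the rule, redetermining all blockings. Next, $x_{\ell+1}$ is found: $C=\{v\in L_1:(x_\ell,v)\in E\}$; for $i=1,2,\dots$ query all edges between $L_i$ and the remaining $C$, removing $v$ from $C$ when an edge $(u,v)$ with $u\prec v$ is found; when $|C|=1$ its element is declared $x_{\ell+1}$. -}

module Defs where

open import Data.Nat using (ℕ; zero; suc; _+_; _<_; _≤_; _≡ᵇ_)
open import Data.Fin using (Fin; toℕ; _≟_)
open import Data.Bool using (Bool; true; false; if_then_else_; _∧_)
open import Data.Maybe using (Maybe; just; nothing)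
open import Data.Product using (Σ; _×_; ∃; ∃-syntax)
open import Relation.Nullary using (¬_)
open import Relation.Nullary.Decidable using (⌊_⌋)
open import Relation.Binary.PropositionalEquality using (_≡_; _≢_)

-- Vertices are Fin n, labelled so that the (unknown) true order is the index
-- order: vertex k is x_{k+1}.  u ≺ v means u comes first.
_≺_ : ∀ {n} → Fin n → Fin n → Set
u ≺ v = toℕ u < toℕ v

record IsInputGraph {n : ℕ} (E : Fin n → Fin n → Set) : Set where
  field
    irreflexive : ∀ v → ¬ E v v
    symmetric   : ∀ u v → E u v → E v u
    path        : ∀ u v → suc (toℕ u) ≡ toℕ v → E u v

-- The edge sets E_1, …, E_q (Es i = E_i): every E_i ⊆ E (undirected),
-- E_i is empty unless 1 ≤ i ≤ q, and every edge of E lies in at least one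
-- E_i (the conditioning "some X_i = 1").  This is the support of the random
-- construction; the statement is about every realisation.
record IsEdgeSplit {n : ℕ} (E : Fin n → Fin n → Set) (q : ℕ)
                   (Es : ℕ → Fin n → Fin n → Set) : Set where
  field
    sub      : ∀ i u v → Es i u v → E u v
    symm     : ∀ i u v → Es i u v → Es i v u
    range    : ∀ i u v → Es i u v → (1 ≤ i) × (i ≤ q)
    covering : ∀ u v → E u v → ∃[ i ] Es i u v

-- State of the data structure: lvl k v = true iff v ∈ L_k (k ≥ 1), and
-- blk v = just u records that v is currently "blocked by the edge (u,v)".
record Config (n : ℕ) : Set where
  constructor config
  field
    lvl : ℕ → Fin n → Bool
    blk : Fin n → Maybe (Fin n)

open Config public

-- Parameters of the algorithm: q, the constant c, the edge sets E_i and the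
-- rebuild schedule  sched ℓ i  ("ℓ is a multiple of s_i / 32").
module StochasticSort {n : ℕ} (q c : ℕ) (Es : ℕ → Fin n → Fin n → Set)
                      (sched : ℕ → ℕ → Set) where

  full : Config n
  full = config (λ _ _ → true) (λ _ → nothing)

  updLvl : ℕ → Fin n → Bool → Config n → Config n
  updLvl j v b σ = config (λ k w → if (k ≡ᵇ j) ∧ ⌊ w ≟ v ⌋ then b else lvl σ k w) (blk σ)

  updBlk : Fin n → Maybe (Fin n) → Config n → Config n
  updBlk v m σ = config (lvl σ) (λ w → if ⌊ w ≟ v ⌋ then m else blk σ w)

  remove : Fin n → Config n → Config n
  remove x σ = config (λ k w → if ⌊ w ≟ x ⌋ then false else lvl σ k w)
                      (λ w → if ⌊ w ≟ x ⌋ then nothing else blk σ w)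

  BlockedBy : Config n → ℕ → Fin n → Fin n → Set
  BlockedBy σ j u v = (lvl σ (j + c) u ≡ true) × Es j u v × (u ≺ v)

  data LevelOutcome (k : ℕ) (σ : Config n) (v : Fin n) (σ' : Config n) : Set where
    outside : lvl σ (suc k) v ≡ false → lvl σ' k v ≡ false → blk σ' v ≡ blk σ v →
              LevelOutcome k σ v σ'
    free    : lvl σ (suc k) v ≡ true → (∀ u → ¬ BlockedBy σ k u v) →
              lvl σ' k v ≡ true → blk σ' v ≡ nothing → LevelOutcome k σ v σ'
    blocked : lvl σ (suc k) v ≡ true → (u : Fin n) → BlockedBy σ k u v →
              lvl σ' k v ≡ false → blk σ' v ≡ just u → LevelOutcome k σ v σ'

  BuildLevel : ℕ → Config n → Config n → Set
  BuildLevel k σ σ' = (∀ i w → i ≢ k → lvl σ' i w ≡ lvl σ i w) ×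
                      (∀ v → LevelOutcome k σ v σ')

  data RebuildDown : ℕ → Config n → Config n → Set where
    done : ∀ {σ} → RebuildDown 0 σ σ
    step : ∀ {k σ σ₁ σ₂} → BuildLevel (suc k) σ σ₁ → RebuildDown k σ₁ σ₂ →
           RebuildDown (suc k) σ σ₂

  data Rebuilds (ℓ : ℕ) : ℕ → Config n → Config n → Set where
    none : ∀ {σ} → Rebuilds ℓ 0 σ σ
    doit : ∀ {k σ σ₁ σ₂} → sched ℓ (suc k) → RebuildDown (suc k) σ σ₁ →
           Rebuilds ℓ k σ₁ σ₂ → Rebuilds ℓ (suc k) σ σ₂
    skip : ∀ {k σ σ₂} → ¬ sched ℓ (suc k) → Rebuilds ℓ k σ σ₂ →
           Rebuilds ℓ (suc k) σ σ₂

  private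
    addTo : ℕ → Fin n → Config n → Config n
    addTo j v σ = updBlk v nothing (updLvl j v true σ)

  data Descend (v : Fin n) : ℕ → Config n → Config n → Set where
    newBlock : ∀ {j σ} (u : Fin n) → BlockedBy σ (suc j) u v →
               Descend v (suc j) σ (updBlk v (just u) σ)
    reachL₁  : ∀ {σ} → (∀ u → ¬ BlockedBy σ 1 u v) → Descend v 1 σ (addTo 1 v σ)
    goDown   : ∀ {j σ σ'} → (∀ u → ¬ BlockedBy σ (suc (suc j)) u v) →
               Descend v (suc j) (addTo (suc (suc j)) v σ) σ' →
               Descend v (suc (suc j)) σ σ'

  data Incr (x : Fin n) : Config n → Config n → Set where
    finish  : ∀ {σ} → (∀ v → blk σ v ≢ just x) → Incr x σ σ
    process : ∀ {σ σ₁ σ₂} (v : Fin n) (j : ℕ) → blk σ v ≡ just x →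
              lvl σ (suc (suc j)) v ≡ true → lvl σ (suc j) v ≡ false →
              Descend v (suc j) σ σ₁ → Incr x σ₁ σ₂ → Incr x σ σ₂

  -- Run ℓ σ : σ is a possible state after x_1, …, x_ℓ have been discovered
  -- and all corresponding level updates have been performed.
  -- (vertex with index ℓ is x_{ℓ+1}.)
  data Run : ℕ → Config n → Set where
    start : ∀ {σ} → RebuildDown q full σ → Run 0 σ
    next  : ∀ {ℓ σ σ₁ σ₂} → Run ℓ σ → (x : Fin n) → toℕ x ≡ ℓ →
            Incr x (remove x σ) σ₁ → Rebuilds (suc ℓ) q σ₁ σ₂ → Run (suc ℓ) σ₂

-- After x_1, …, x_ℓ are discovered, every level contains only undiscovered
-- vertices, the indices of the levels containing an undiscovered vertex w
-- form an up-set, and a vertex missing from L_1 carries a recorded blocker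
-- u ≺ w that is itself undiscovered.  A rebuild only ever records blockers
-- taken from some level, hence undiscovered; the incremental update repairs
-- exactly the vertices whose recorded blocker was x_ℓ.  Since x_{ℓ+1} is the
-- least undiscovered vertex it has no undiscovered predecessor, so it cannot
-- be missing from L_1.
module Submission where

open import Defs
open import Data.Nat using (ℕ; zero; suc; _≤_; _<_; _≡ᵇ_; z≤n; s≤s)
open import Data.Nat.Properties
  using (≡ᵇ⇒≡; ≡⇒≡ᵇ; 1+n≢n; ≤-refl; ≤-trans; ≤-pred; <⇒≤; ≤-reflexive; n≤1+n;
         ≤∧≢⇒<; ≤-<-trans; <-irrefl; >⇒≢; m<n⇒m<1+n; m≤n⇒m<n∨m≡n)
import Data.Nat.Properties as ℕₚ
open import Data.Fin using (Fin; toℕ; _≟_)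
open import Data.Fin.Properties using (toℕ-injective)
open import Data.Bool using (true; false)
open import Data.Bool.Properties using (not-¬; ¬-not)
open import Data.Maybe using (just; nothing)
open import Data.Product using (∃-syntax; _×_; _,_)
open import Data.Sum using (inj₁; inj₂)
open import Data.Unit using (tt)
open import Relation.Nullary using (¬_; Dec; yes; no; contradiction)
open import Relation.Binary.PropositionalEquality
  using (_≡_; _≢_; refl; sym; trans; cong)

module Correctness {n : ℕ} (q c : ℕ) (Es : ℕ → Fin n → Fin n → Set)
                   (sched : ℕ → ℕ → Set) where
  open StochasticSort q c Es sched

  updLvl-hit : ∀ j v b σ → lvl (updLvl j v b σ) j v ≡ b
  updLvl-hit j v b σ with j ≡ᵇ j | ≡⇒≡ᵇ j j refl | v ≟ v
  ... | true | _ | yes _   = refl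
  ... | true | _ | no v≢v = contradiction refl v≢v

  updLvl-level≢ : ∀ j v b σ {k} w → k ≢ j → lvl (updLvl j v b σ) k w ≡ lvl σ k w
  updLvl-level≢ j v b σ {k} w k≢j with k ≡ᵇ j | ≡ᵇ⇒≡ k j
  ... | false | _   = refl
  ... | true  | k≡j = contradiction (k≡j tt) k≢j

  updLvl-vertex≢ : ∀ j v b σ k {w} → w ≢ v → lvl (updLvl j v b σ) k w ≡ lvl σ k w
  updLvl-vertex≢ j v b σ k {w} w≢v with k ≡ᵇ j | w ≟ v
  ... | _     | yes w≡v = contradiction w≡v w≢v
  ... | true  | no _    = refl
  ... | false | no _    = refl

  updBlk-hit : ∀ v m σ → blk (updBlk v m σ) v ≡ m
  updBlk-hit v m σ with v ≟ v
  ... | yes _   = refl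
  ... | no v≢v = contradiction refl v≢v

  updBlk-vertex≢ : ∀ v m σ {w} → w ≢ v → blk (updBlk v m σ) w ≡ blk σ w
  updBlk-vertex≢ v m σ {w} w≢v with w ≟ v
  ... | yes w≡v = contradiction w≡v w≢v
  ... | no _    = refl

  remove-hit : ∀ x σ k → lvl (remove x σ) k x ≡ false
  remove-hit x σ k with x ≟ x
  ... | yes _   = refl
  ... | no x≢x = contradiction refl x≢x

  remove-lvl-vertex≢ : ∀ x σ k {w} → w ≢ x → lvl (remove x σ) k w ≡ lvl σ k w
  remove-lvl-vertex≢ x σ k {w} w≢x with w ≟ x
  ... | yes w≡x = contradiction w≡x w≢x
  ... | no _    = refl

  remove-blk-vertex≢ : ∀ x σ {w} → w ≢ x → blk (remove x σ) w ≡ blk σ w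
  remove-blk-vertex≢ x σ {w} w≢x with w ≟ x
  ... | yes w≡x = contradiction w≡x w≢x
  ... | no _    = refl

  Upward : ℕ → Config n → Fin n → Set
  Upward t σ w = ∀ k → t ≤ k → lvl σ k w ≡ true → lvl σ (suc k) w ≡ true

  BlockedFrom : ℕ → Config n → Fin n → Set
  BlockedFrom b σ w = ∃[ u ] (blk σ w ≡ just u × u ≺ w × b ≤ toℕ u)

  record Settled (b t : ℕ) (σ : Config n) (w : Fin n) : Set where
    field
      upward  : Upward t σ w
      blocker : lvl σ t w ≡ false → BlockedFrom b σ w

  MembersFrom : ℕ → Config n → Set
  MembersFrom lo σ = ∀ k w → lvl σ k w ≡ true → lo ≤ toℕ w

  -- lo counts the discovered vertices, b bounds the recorded blockers from
  -- below (b = lo ∸ 1 while the vertices blocked by the newest x are being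
  -- repaired), and levels below t are the ones still to be rebuilt.
  record Invariant (lo b t : ℕ) (σ : Config n) : Set where
    field
      members : MembersFrom lo σ
      settled : ∀ w → lo ≤ toℕ w → Settled b t σ w

  open Settled
  open Invariant

  upward-cons : ∀ {t σ w} → (lvl σ t w ≡ true → lvl σ (suc t) w ≡ true) →
                Upward (suc t) σ w → Upward t σ w
  upward-cons t-step up k t≤k with m≤n⇒m<n∨m≡n t≤k
  ... | inj₁ t<k  = up k t<k
  ... | inj₂ refl = t-step

  upward-reach : ∀ {t k σ w} → Upward t σ w → t ≤ k → lvl σ t w ≡ true → lvl σ k w ≡ true
  upward-reach {k = zero}  up z≤n   w∈L = w∈L
  upward-reach {k = suc k} {σ} up t≤1+k w∈L with m≤n⇒m<n∨m≡n t≤1+k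
  ... | inj₁ t<1+k = up k (≤-pred t<1+k) (upward-reach {σ = σ} up (≤-pred t<1+k) w∈L)
  ... | inj₂ refl  = w∈L

  upward-add : ∀ {t j v σ} → lvl σ (suc j) v ≡ true → Upward t σ v →
               Upward t (updLvl j v true σ) v
  upward-add {j = j} {v} {σ} v∈L up k t≤k v∈Lₖ with k ℕₚ.≟ j
  ... | yes refl = trans (updLvl-level≢ j v true σ v 1+n≢n) v∈L
  ... | no k≢j with suc k ℕₚ.≟ j
  ...   | yes refl  = updLvl-hit j v true σ
  ...   | no 1+k≢j  = trans (updLvl-level≢ j v true σ v 1+k≢j)
                            (up k t≤k (trans (sym (updLvl-level≢ j v true σ v k≢j)) v∈Lₖ))

  blockedFrom-transport : ∀ {b σ σ′ w} → blk σ′ w ≡ blk σ w →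
                          BlockedFrom b σ w → BlockedFrom b σ′ w
  blockedFrom-transport blk≡ (u , blk≡u , u≺w , b≤u) = u , trans blk≡ blk≡u , u≺w , b≤u

  settled-transport : ∀ {b t σ σ′ w} → (∀ k → lvl σ′ k w ≡ lvl σ k w) →
                      blk σ′ w ≡ blk σ w → Settled b t σ w → Settled b t σ′ w
  settled-transport {t = t} {σ} {σ′} lvl≡ blk≡ s = record
    { upward  = λ k t≤k w∈L → trans (lvl≡ (suc k)) (upward s k t≤k (trans (sym (lvl≡ k)) w∈L))
    ; blocker = λ w∉L →
        blockedFrom-transport {σ = σ} {σ′} blk≡ (blocker s (trans (sym (lvl≡ t)) w∉L))
    }

  settled-updLvl : ∀ {b t j v bit σ w} → w ≢ v → Settled b t σ w →
                   Settled b t (updLvl j v bit σ) w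
  settled-updLvl {j = j} {v} {bit} {σ} w≢v =
    settled-transport {σ = σ} (λ k → updLvl-vertex≢ j v bit σ k w≢v) refl

  settled-updBlk : ∀ {b t v m σ w} → w ≢ v → Settled b t σ w → Settled b t (updBlk v m σ) w
  settled-updBlk {v = v} {m} {σ} w≢v =
    settled-transport (λ _ → refl) (updBlk-vertex≢ v m σ w≢v)

  invariant-raise : ∀ {lo b t t′ σ} → t ≤ t′ → Invariant lo b t σ → Invariant lo b t′ σ
  invariant-raise {σ = σ} t≤t′ inv = record
    { members = members inv
    ; settled = λ w lo≤w → let s = settled inv w lo≤w in record
        { upward  = λ k t′≤k → upward s k (≤-trans t≤t′ t′≤k)
        ; blocker = λ w∉Lt′ → blocker s (¬-not λ w∈Lt →
                      not-¬ (upward-reach {σ = σ} (upward s) t≤t′ w∈Lt) w∉Lt′)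
        }
    }

  full-invariant : ∀ t → Invariant 0 0 t full
  full-invariant t = record
    { members = λ _ _ _ → z≤n
    ; settled = λ _ _ → record { upward = λ _ _ _ → refl ; blocker = λ () }
    }

  buildLevel-preserves : ∀ {lo b k σ σ₁} → b ≤ lo → Invariant lo b (suc (suc k)) σ →
                         BuildLevel (suc k) σ σ₁ → Invariant lo b (suc k) σ₁
  buildLevel-preserves {lo} {b} {k} {σ} {σ₁} b≤lo inv (same , outcome) = record
    { members = members′ ; settled = settled′ }
    where
    members′ : MembersFrom lo σ₁
    members′ i w w∈L with i ℕₚ.≟ suc k
    ... | no i≢k+1 = members inv i w (trans (sym (same i w i≢k+1)) w∈L)
    ... | yes refl with outcome w
    ...   | outside _ w∉L _   = contradiction w∉L (not-¬ w∈L)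
    ...   | free w∈L′ _ _ _   = members inv (suc (suc k)) w w∈L′
    ...   | blocked _ _ _ w∉L _ = contradiction w∉L (not-¬ w∈L)

    above : ∀ {w} → Upward (suc (suc k)) σ w → Upward (suc (suc k)) σ₁ w
    above {w} up k′ k+1<k′ w∈L =
      trans (same (suc k′) w (>⇒≢ (m<n⇒m<1+n k+1<k′)))
            (up k′ k+1<k′ (trans (sym (same k′ w (>⇒≢ k+1<k′))) w∈L))

    settled′ : ∀ w → lo ≤ toℕ w → Settled b (suc k) σ₁ w
    settled′ w lo≤w with settled inv w lo≤w | outcome w
    ... | s | outside w∉L w∉L′ blk≡ = record
      { upward  = upward-cons {σ = σ₁} (λ w∈L′ → contradiction w∉L′ (not-¬ w∈L′)) (above (upward s))
      ; blocker = λ _ → blockedFrom-transport {σ = σ} {σ₁} blk≡ (blocker s w∉L)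
      }
    ... | s | free w∈L _ w∈L′ _ = record
      { upward  = upward-cons {σ = σ₁} (λ _ → trans (same (suc (suc k)) w 1+n≢n) w∈L) (above (upward s))
      ; blocker = λ w∉L′ → contradiction w∉L′ (not-¬ w∈L′)
      }
    ... | s | blocked _ u (u∈L , _ , u≺w) w∉L′ blk≡u = record
      { upward  = upward-cons {σ = σ₁} (λ w∈L′ → contradiction w∉L′ (not-¬ w∈L′)) (above (upward s))
      ; blocker = λ _ → u , blk≡u , u≺w , ≤-trans b≤lo (members inv _ u u∈L)
      }

  rebuildDown-preserves : ∀ {lo b k σ σ′} → b ≤ lo → Invariant lo b (suc k) σ →
                          RebuildDown k σ σ′ → Invariant lo b 1 σ′
  rebuildDown-preserves b≤lo inv done         = inv
  rebuildDown-preserves b≤lo inv (step bl rd) =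
    rebuildDown-preserves b≤lo (buildLevel-preserves b≤lo inv bl) rd

  rebuilds-preserves : ∀ {lo b ℓ k σ σ′} → b ≤ lo → Invariant lo b 1 σ →
                       Rebuilds ℓ k σ σ′ → Invariant lo b 1 σ′
  rebuilds-preserves b≤lo inv none = inv
  rebuilds-preserves b≤lo inv (doit _ rd rs) =
    rebuilds-preserves b≤lo (rebuildDown-preserves b≤lo (invariant-raise (s≤s z≤n) inv) rd) rs
  rebuilds-preserves b≤lo inv (skip _ rs) = rebuilds-preserves b≤lo inv rs

  members-add : ∀ {lo j v σ} → MembersFrom lo σ → lo ≤ toℕ v →
                MembersFrom lo (updLvl j v true σ)
  members-add {lo} {j} {v} {σ} mem lo≤v k w w∈L = byVertex (w ≟ v)
    where
    byVertex : Dec (w ≡ v) → lo ≤ toℕ w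
    byVertex (yes refl) = lo≤v
    byVertex (no w≢v)   = mem k w (trans (sym (updLvl-vertex≢ j v true σ k w≢v)) w∈L)

  descend-preserves : ∀ {lo b v m σ σ′} → b ≤ lo → MembersFrom lo σ → lo ≤ toℕ v →
                      (∀ w → w ≢ v → lo ≤ toℕ w → Settled b 1 σ w) →
                      Upward 1 σ v → lvl σ (suc m) v ≡ true →
                      Descend v m σ σ′ → Invariant lo b 1 σ′
  descend-preserves {lo} {b} {v} {σ = σ} b≤lo mem lo≤v others up _
                    (newBlock u (u∈L , _ , u≺v)) = record
    { members = mem ; settled = settled′ }
    where
    settled′ : ∀ w → lo ≤ toℕ w → Settled b 1 (updBlk v (just u) σ) w
    settled′ w lo≤w with w ≟ v
    ... | no w≢v  = settled-updBlk w≢v (others w w≢v lo≤w)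
    ... | yes refl = record
      { upward  = up
      ; blocker = λ _ → u , updBlk-hit v (just u) σ , u≺v , ≤-trans b≤lo (mem _ u u∈L)
      }
  descend-preserves {lo} {b} {v} {σ = σ} b≤lo mem lo≤v others up v∈L₂ (reachL₁ _) =
    record { members = members-add {j = 1} {σ = σ} mem lo≤v ; settled = settled′ }
    where
    settled′ : ∀ w → lo ≤ toℕ w → Settled b 1 (updBlk v nothing (updLvl 1 v true σ)) w
    settled′ w lo≤w with w ≟ v
    ... | no w≢v  = settled-updBlk w≢v (settled-updLvl w≢v (others w w≢v lo≤w))
    ... | yes refl = record
      { upward  = upward-add {σ = σ} v∈L₂ up
      ; blocker = λ v∉L₁ → contradiction v∉L₁ (not-¬ (updLvl-hit 1 v true σ))
      }
  descend-preserves {lo} {b} {v} {suc (suc j)} {σ} b≤lo mem lo≤v others up v∈L (goDown _ d) =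
    descend-preserves b≤lo (members-add {j = suc (suc j)} {σ = σ} mem lo≤v) lo≤v
      (λ w w≢v lo≤w → settled-updBlk w≢v (settled-updLvl w≢v (others w w≢v lo≤w)))
      (upward-add {σ = σ} v∈L up) (updLvl-hit (suc (suc j)) v true σ) d

  incr-preserves : ∀ {ℓ x σ σ′} → toℕ x ≡ ℓ → Invariant (suc ℓ) ℓ 1 σ → Incr x σ σ′ →
                   Invariant (suc ℓ) (suc ℓ) 1 σ′
  incr-preserves {ℓ} {x} {σ} x≡ℓ inv (finish unblocked) = record
    { members = members inv
    ; settled = λ w ℓ<w → let s = settled inv w ℓ<w in record
        { upward = upward s ; blocker = λ w∉L → raise w (blocker s w∉L) }
    }
    where
    raise : ∀ w → BlockedFrom ℓ σ w → BlockedFrom (suc ℓ) σ w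
    raise w (u , blk≡u , u≺w , ℓ≤u) = u , blk≡u , u≺w , ≤∧≢⇒< ℓ≤u λ ℓ≡u →
      unblocked w (trans blk≡u (cong just (toℕ-injective (trans (sym ℓ≡u) (sym x≡ℓ)))))
  incr-preserves {ℓ} x≡ℓ inv (process v _ _ v∈L _ d rest) =
    incr-preserves x≡ℓ (descend-preserves (n≤1+n ℓ) (members inv) ℓ<v
                          (λ w _ ℓ<w → settled inv w ℓ<w) (upward (settled inv v ℓ<v)) v∈L d)
                   rest
    where
    ℓ<v = members inv _ v v∈L

  remove-preserves : ∀ {ℓ x σ} → toℕ x ≡ ℓ → Invariant ℓ ℓ 1 σ →
                     Invariant (suc ℓ) ℓ 1 (remove x σ)
  remove-preserves {ℓ} {x} {σ} x≡ℓ inv = record { members = members′ ; settled = settled′ }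
    where
    members′ : MembersFrom (suc ℓ) (remove x σ)
    members′ k w w∈L = byVertex (w ≟ x)
      where
      byVertex : Dec (w ≡ x) → suc ℓ ≤ toℕ w
      byVertex (yes refl) = contradiction (remove-hit x σ k) (not-¬ w∈L)
      byVertex (no w≢x)   =
        ≤∧≢⇒< (members inv k w (trans (sym (remove-lvl-vertex≢ x σ k w≢x)) w∈L))
              λ ℓ≡w → w≢x (toℕ-injective (trans (sym ℓ≡w) (sym x≡ℓ)))

    settled′ : ∀ w → suc ℓ ≤ toℕ w → Settled ℓ 1 (remove x σ) w
    settled′ w ℓ<w = settled-transport (λ k → remove-lvl-vertex≢ x σ k w≢x)
                       (remove-blk-vertex≢ x σ w≢x) (settled inv w (<⇒≤ ℓ<w))
      where
      w≢x : w ≢ x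
      w≢x refl = <-irrefl (sym x≡ℓ) ℓ<w

  run-invariant : ∀ {ℓ σ} → Run ℓ σ → Invariant ℓ ℓ 1 σ
  run-invariant (start rd) = rebuildDown-preserves z≤n (full-invariant (suc q)) rd
  run-invariant (next r x x≡ℓ inc rs) =
    rebuilds-preserves ≤-refl (incr-preserves x≡ℓ (remove-preserves x≡ℓ (run-invariant r)) inc) rs

  least-undiscovered∈L₁ : ∀ {ℓ σ} → Invariant ℓ ℓ 1 σ → (x : Fin n) → toℕ x ≡ ℓ →
                          lvl σ 1 x ≡ true
  least-undiscovered∈L₁ {ℓ} {σ} inv x x≡ℓ =
    ¬-not λ x∉L₁ → noBlocker (blocker (settled inv x (≤-reflexive (sym x≡ℓ))) x∉L₁)
    where
    noBlocker : ¬ BlockedFrom ℓ σ x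
    noBlocker (u , _ , u≺x , ℓ≤u) = <-irrefl (sym x≡ℓ) (≤-<-trans ℓ≤u u≺x)

corollary1 : ∃[ c₀ ] (∀ (c : ℕ) → c₀ ≤ c → ∀ (n : ℕ) (E : Fin n → Fin n → Set) → IsInputGraph E →
                 ∀ (q : ℕ) → 1 ≤ q → (Es : ℕ → Fin n → Fin n → Set) → IsEdgeSplit E q Es →
                 (sched : ℕ → ℕ → Set) → (ℓ : ℕ) (σ : Config n) →
                 StochasticSort.Run q c Es sched ℓ σ →
                 (x : Fin n) → toℕ x ≡ ℓ → lvl σ 1 x ≡ true)
corollary1 = 0 , λ c _ n _ _ q _ Es _ sched _ _ run →
  Correctness.least-undiscovered∈L₁ q c Es sched (Correctness.run-invariant q c Es sched run)
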